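{- Let $n,k$ be integers with $3\leq k\leq n-1$ and let $G$ be a graph on $n$ vertices which is the $(1,2)$-step competition graph $C_{1,2}(T)$ of some strong $k$-hypertournament $T$ on $n$ vertices. Then the complement $G^{c}$ of $G$ does not contain $K_{1,3}$ as a subgraph.
   Context: Given integers $n\geq k>1$, a $k$-hypertournament on $n$ vertices is a pair $T=(V,A)$ where $|V|=n$ and $A$ is a set of $k$-tuples of distinct vertices (arcs) such that for every $k$-subset $S$ of $V$, $A$ contains exactly one of the $k!$ $k$-tuples whose entries are the elements of $S$. A path in $T$ is a sequence $v_1a_1v_2a_2\cdots a_{t-1}v_t$ of distinct vertices $v_1,\dots,v_t$ ($t\geq1$) and distinct arcs $a_1,\dots,a_{t-1}$ such that $v_i$ precedes $v_{i+1}$ in $a_i$; its length $l(\cdot)$ is the number of arcs, and it is an $(x,y)$-path if $v_1=x$, $v_t=y$. $T$ is strong if it has an $(x,y)$-path for every ordered pair of distinct vertices. $C_{1,2}(T)$ is the graph on $V(T)$ in which $xy$ is an edge if and only if there exist a vertex $z\neq x,y$, an $(x,z)$-path $P$ and a $(y,z)$-path $Q$ such that: $y\notin V(P)$, $x\notin V(Q)$; either ($l(P)\leq 1$ and $l(Q)\leq 2$) or ($l(Q)\leq 1$ and $l(P)\leq 2$); and $P$, $Q$ are arc-disjoint. $G^c$ is the graph on $V(G)$ whose edges are the non-adjacent pairs of $G$. -}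

module Defs where

open import Data.Nat using (ℕ; zero; suc; _≤_)
open import Data.Fin using (Fin; zero; suc; inject₁; fromℕ; _<_)
open import Data.Vec using (Vec; lookup)
open import Data.Vec.Membership.Propositional using (_∈_)
open import Data.Product using (Σ; ∃; ∃-syntax; _×_; _,_)
open import Data.Sum using (_⊎_)
open import Function using (Injective)
open import Relation.Binary.PropositionalEquality using (_≡_; _≢_)
open import Relation.Nullary using (¬_)

Distinct : ∀ {n k} → Vec (Fin n) k → Set
Distinct {n} {k} t = Injective _≡_ _≡_ (lookup t)

SameEntries : ∀ {n k} → Vec (Fin n) k → Vec (Fin n) k → Set
SameEntries t t' = ∀ x → (x ∈ t → x ∈ t') × (x ∈ t' → x ∈ t)

-- For each k-subset S (represented by any distinct k-tuple listing S), exactly one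
-- of the tuples whose entries are the elements of S is an arc.
record Hypertournament (n k : ℕ) : Set₁ where
  field
    Arc      : Vec (Fin n) k → Set
    arc-distinct : ∀ a → Arc a → Distinct a
    arc-exists   : ∀ t → Distinct t → ∃[ a ] (Arc a × SameEntries t a)
    arc-unique   : ∀ a b → Arc a → Arc b → SameEntries a b → a ≡ b
open Hypertournament public

Precedes : ∀ {n k} → Fin n → Fin n → Vec (Fin n) k → Set
Precedes {n} {k} x y a = ∃[ i ] ∃[ j ] (i < j × lookup a i ≡ x × lookup a j ≡ y)

record Path {n k : ℕ} (T : Hypertournament n k) : Set where
  field
    len  : ℕ
    vert : Fin (suc len) → Fin n
    arc  : Fin len → Vec (Fin n) k
    vert-inj : Injective _≡_ _≡_ vert
    arc-inj  : Injective _≡_ _≡_ arc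
    arc-in   : ∀ i → Arc T (arc i)
    step     : ∀ i → Precedes (vert (inject₁ i)) (vert (suc i)) (arc i)
open Path public

start end : ∀ {n k} {T : Hypertournament n k} → Path T → Fin n
start P = vert P zero
end P = vert P (fromℕ (len P))

IsPathFromTo : ∀ {n k} {T : Hypertournament n k} → Path T → Fin n → Fin n → Set
IsPathFromTo P x y = start P ≡ x × end P ≡ y

OnPath : ∀ {n k} {T : Hypertournament n k} → Fin n → Path T → Set
OnPath x P = ∃[ i ] (vert P i ≡ x)

ArcDisjoint : ∀ {n k} {T : Hypertournament n k} → Path T → Path T → Set
ArcDisjoint P Q = ∀ i j → arc P i ≢ arc Q j

Strong : ∀ {n k} → Hypertournament n k → Set
Strong {n} T = ∀ (x y : Fin n) → x ≢ y → ∃[ P ] (IsPathFromTo {T = T} P x y)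

C12Edge : ∀ {n k} → Hypertournament n k → Fin n → Fin n → Set
C12Edge {n} T x y =
  x ≢ y ×
  ∃[ z ] ∃[ P ] ∃[ Q ]
    ( z ≢ x × z ≢ y
    × IsPathFromTo {T = T} P x z × IsPathFromTo {T = T} Q y z
    × ¬ OnPath y P × ¬ OnPath x Q
    × ((len P ≤ 1 × len Q ≤ 2) ⊎ (len Q ≤ 1 × len P ≤ 2))
    × ArcDisjoint P Q )

ComplEdge : ∀ {n} → (Fin n → Fin n → Set) → Fin n → Fin n → Set
ComplEdge E x y = x ≢ y × ¬ E x y

ContainsK13 : ∀ {n} → (Fin n → Fin n → Set) → Set
ContainsK13 {n} E =
  ∃[ c ] ∃[ a ] ∃[ b ] ∃[ d ]
    ( a ≢ b × a ≢ d × b ≢ d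
    × E c a × E c b × E c d )

module Submission where

-- Strong connectivity gives the centre c of a K_{1,3} in the complement an arc in which c precedes
-- some q, and two of the three non-neighbours y₁, y₂ of c differ from q. As 3 ≤ k < n, some arc g
-- contains q, y₁, y₂ but not c, and some arc h contains c, y₁, y₂ but not q. If a yᵢ precedes q in g,
-- then c and yᵢ reach q by single arcs; otherwise, if yᵢ precedes yⱼ in h, the 2-path c → q → yⱼ and
-- the arc from yᵢ to yⱼ make c yᵢ an edge of C_{1,2}(T). Either way c has a neighbour among y₁, y₂.

open import Defs
open import Data.Nat as ℕ using (ℕ; _≤_; _<_; z≤n; s≤s)
open import Data.Nat.Properties using (m≤n⇒m<n∨m≡n; <⇒≤; <⇒≱)
open import Data.Fin using (Fin; zero; suc; _≟_)
open import Data.Fin.Properties using (<-cmp; <⇒≢; injective⇒≤; all?; ¬∀⟶∃¬)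
open import Data.Vec using (Vec; []; _∷_; lookup)
open import Data.Vec.Relation.Unary.Any using (here; there; index)
open import Data.Vec.Relation.Unary.Any.Properties using (lookup-index)
open import Data.Vec.Membership.Propositional using (_∈_; _∉_)
open import Data.Vec.Membership.Propositional.Properties using (∈-lookup)
import Data.Vec.Membership.DecPropositional as DecMembership
open import Data.Product using (∃; ∃-syntax; _×_; _,_; proj₁; proj₂)
open import Data.Sum using (_⊎_; inj₁; inj₂; [_,_]′; swap)
open import Function using (Injective; _∘_; id)
open import Relation.Binary using (tri<; tri≈; tri>)
open import Relation.Binary.PropositionalEquality using (_≡_; _≢_; refl; sym; trans; cong; subst; ≢-sym)
open import Relation.Nullary using (¬_; Dec; yes; no; contradiction)

_⊆_ : ∀ {A : Set} {m l} → Vec A m → Vec A l → Set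
xs ⊆ ys = ∀ {x} → x ∈ xs → x ∈ ys

∉-∷ : ∀ {A : Set} {m} {x y : A} {ys : Vec A m} → x ≢ y → x ∉ ys → x ∉ y ∷ ys
∉-∷ x≢y x∉ys (here x≡y) = x≢y x≡y
∉-∷ x≢y x∉ys (there x∈ys) = x∉ys x∈ys

lookup-injective-[] : ∀ {A : Set} → Injective _≡_ _≡_ (lookup {A = A} [])
lookup-injective-[] {x = ()}

lookup-injective-∷ : ∀ {A : Set} {m} {x : A} {xs : Vec A m} →
  x ∉ xs → Injective _≡_ _≡_ (lookup xs) → Injective _≡_ _≡_ (lookup (x ∷ xs))
lookup-injective-∷ _ _ {zero} {zero} _ = refl
lookup-injective-∷ {xs = xs} x∉xs _ {zero} {suc j} x≡xⱼ =
  contradiction (subst (_∈ xs) (sym x≡xⱼ) (∈-lookup j xs)) x∉xs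
lookup-injective-∷ {xs = xs} x∉xs _ {suc i} {zero} xᵢ≡x =
  contradiction (subst (_∈ xs) xᵢ≡x (∈-lookup i xs)) x∉xs
lookup-injective-∷ _ inj {suc i} {suc j} xᵢ≡xⱼ = cong suc (inj xᵢ≡xⱼ)

lookup-injective₂ : ∀ {A : Set} {x y : A} → x ≢ y → Injective _≡_ _≡_ (lookup (x ∷ y ∷ []))
lookup-injective₂ x≢y = lookup-injective-∷ (∉-∷ x≢y λ ()) (lookup-injective-∷ (λ ()) lookup-injective-[])

lookup-injective₃ : ∀ {A : Set} {x y z : A} → x ≢ y → x ≢ z → y ≢ z →
  Injective _≡_ _≡_ (lookup (x ∷ y ∷ z ∷ []))
lookup-injective₃ x≢y x≢z y≢z =
  lookup-injective-∷ (∉-∷ x≢y (∉-∷ x≢z λ ())) (lookup-injective₂ y≢z)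

_∈?_ : ∀ {n m} (x : Fin n) (xs : Vec (Fin n) m) → Dec (x ∈ xs)
x ∈? xs = DecMembership._∈?_ _≟_ x xs

fresh : ∀ {m n} → m < n → (xs : Vec (Fin n) m) → ∃[ y ] y ∉ xs
fresh {m} {n} m<n xs with all? (_∈? xs)
... | no ¬all∈ = ¬∀⟶∃¬ n (_∈ xs) (_∈? xs) ¬all∈
... | yes all∈ = contradiction (injective⇒≤ index-injective) (<⇒≱ m<n)
  where
  index-injective : Injective _≡_ _≡_ (λ y → index (all∈ y))
  index-injective {x} {y} eq =
    trans (lookup-index (all∈ x)) (trans (cong (lookup xs) eq) (sym (lookup-index (all∈ y))))

extend-distinct : ∀ {n m k} {r : Fin n} {xs : Vec (Fin n) m} → m ≤ k → k < n →
  Distinct xs → r ∉ xs → ∃ λ (ys : Vec (Fin n) k) → Distinct ys × r ∉ ys × xs ⊆ ys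
extend-distinct {k = ℕ.zero} z≤n _ dxs r∉xs = _ , dxs , r∉xs , id
extend-distinct {k = ℕ.suc k} m≤1+k 1+k<n dxs r∉xs with m≤n⇒m<n∨m≡n m≤1+k
... | inj₂ refl = _ , dxs , r∉xs , id
... | inj₁ (s≤s m≤k) with extend-distinct m≤k (<⇒≤ 1+k<n) dxs r∉xs
...   | ys , dys , r∉ys , xs⊆ys with fresh 1+k<n (_ ∷ ys)
...     | y , y∉r∷ys =
  y ∷ ys , lookup-injective-∷ (y∉r∷ys ∘ there) dys ,
  ∉-∷ (λ r≡y → y∉r∷ys (here (sym r≡y))) r∉ys , there ∘ xs⊆ys

arc-containing : ∀ {n m k} {r : Fin n} {xs : Vec (Fin n) m} (T : Hypertournament n k) →
  m ≤ k → k < n → Distinct xs → r ∉ xs → ∃[ a ] (Arc T a × xs ⊆ a × r ∉ a)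
arc-containing {r = r} T m≤k k<n dxs r∉xs with extend-distinct m≤k k<n dxs r∉xs
... | ys , dys , r∉ys , xs⊆ys with arc-exists T ys dys
... | a , A , same = a , A , (λ x∈xs → proj₁ (same _) (xs⊆ys x∈xs)) , r∉ys ∘ proj₂ (same r)

module _ {n k : ℕ} where

  precedes⇒∈ˡ : ∀ {x y : Fin n} {a : Vec (Fin n) k} → Precedes x y a → x ∈ a
  precedes⇒∈ˡ {a = a} (i , _ , _ , aᵢ≡x , _) = subst (_∈ a) aᵢ≡x (∈-lookup i a)

  precedes⇒∈ʳ : ∀ {x y : Fin n} {a : Vec (Fin n) k} → Precedes x y a → y ∈ a
  precedes⇒∈ʳ {a = a} (_ , j , _ , _ , aⱼ≡y) = subst (_∈ a) aⱼ≡y (∈-lookup j a)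

  precedes⇒≢ : ∀ {x y : Fin n} {a : Vec (Fin n) k} → Distinct a → Precedes x y a → x ≢ y
  precedes⇒≢ da (i , j , i<j , aᵢ≡x , aⱼ≡y) x≡y = <⇒≢ i<j (da (trans aᵢ≡x (trans x≡y (sym aⱼ≡y))))

  precedes-total : ∀ {x y : Fin n} {a : Vec (Fin n) k} → x ∈ a → y ∈ a → x ≢ y →
    Precedes x y a ⊎ Precedes y x a
  precedes-total {a = a} x∈a y∈a x≢y with <-cmp (index x∈a) (index y∈a)
  ... | tri< i<j _ _ = inj₁ (_ , _ , i<j , sym (lookup-index x∈a) , sym (lookup-index y∈a))
  ... | tri> _ _ j<i = inj₂ (_ , _ , j<i , sym (lookup-index y∈a) , sym (lookup-index x∈a))
  ... | tri≈ _ i≡j _ =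
    contradiction (trans (lookup-index x∈a) (trans (cong (lookup a) i≡j) (sym (lookup-index y∈a)))) x≢y

module _ {n k : ℕ} (T : Hypertournament n k) where

  arc-precedes⇒≢ : ∀ {x y a} → Arc T a → Precedes x y a → x ≢ y
  arc-precedes⇒≢ {a = a} A = precedes⇒≢ {a = a} (arc-distinct T a A)

  path₁ : ∀ {x z a} → Arc T a → Precedes x z a → Path T
  path₁ {x} {z} {a} A x→z = record
    { len = 1 ; vert = lookup (x ∷ z ∷ []) ; arc = lookup (a ∷ [])
    ; vert-inj = lookup-injective₂ (arc-precedes⇒≢ A x→z)
    ; arc-inj = lookup-injective-∷ (λ ()) lookup-injective-[]
    ; arc-in = λ { zero → A } ; step = λ { zero → x→z } }

  path₂ : ∀ {x w z a b} → Arc T a → Arc T b → a ≢ b → x ≢ z →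
    Precedes x w a → Precedes w z b → Path T
  path₂ {x} {w} {z} {a} {b} A B a≢b x≢z x→w w→z = record
    { len = 2 ; vert = lookup (x ∷ w ∷ z ∷ []) ; arc = lookup (a ∷ b ∷ [])
    ; vert-inj = lookup-injective₃ (arc-precedes⇒≢ A x→w) x≢z (arc-precedes⇒≢ B w→z)
    ; arc-inj = lookup-injective₂ a≢b
    ; arc-in = λ { zero → A ; (suc zero) → B } ; step = λ { zero → x→w ; (suc zero) → w→z } }

  c12Edge₁₁ : ∀ {x y z a b} → Arc T a → Arc T b → a ≢ b →
    Precedes x z a → Precedes y z b → x ≢ y → C12Edge T x y
  c12Edge₁₁ A B a≢b x→z y→z x≢y =
    x≢y , _ , path₁ A x→z , path₁ B y→z , z≢x , z≢y , (refl , refl) , (refl , refl) ,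
    (λ { (zero , x≡y) → x≢y x≡y ; (suc zero , z≡y) → z≢y z≡y }) ,
    (λ { (zero , y≡x) → x≢y (sym y≡x) ; (suc zero , z≡x) → z≢x z≡x }) ,
    inj₁ (s≤s z≤n , s≤s z≤n) , λ { zero zero → a≢b }
    where
    z≢x = ≢-sym (arc-precedes⇒≢ A x→z)
    z≢y = ≢-sym (arc-precedes⇒≢ B y→z)

  c12Edge₂₁ : ∀ {x y w z a b h} → Arc T a → Arc T b → Arc T h → a ≢ b → a ≢ h → b ≢ h →
    Precedes x w a → Precedes w z b → Precedes y z h → x ≢ y → x ≢ z → w ≢ y → C12Edge T x y
  c12Edge₂₁ A B H a≢b a≢h b≢h x→w w→z y→z x≢y x≢z w≢y =
    x≢y , _ , path₂ A B a≢b x≢z x→w w→z , path₁ H y→z , ≢-sym x≢z , z≢y ,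
    (refl , refl) , (refl , refl) ,
    (λ { (zero , x≡y) → x≢y x≡y ; (suc zero , w≡y) → w≢y w≡y ; (suc (suc zero) , z≡y) → z≢y z≡y }) ,
    (λ { (zero , y≡x) → x≢y (sym y≡x) ; (suc zero , z≡x) → x≢z (sym z≡x) }) ,
    inj₂ (s≤s z≤n , s≤s (s≤s z≤n)) , λ { zero zero → a≢h ; (suc zero) zero → b≢h }
    where
    z≢y = ≢-sym (arc-precedes⇒≢ H y→z)

  first-step : (P : Path T) → start P ≢ end P → ∃[ q ] ∃[ e ] (Arc T e × Precedes (start P) q e)
  first-step record { len = ℕ.zero } start≢end = contradiction refl start≢end
  first-step P@record { len = ℕ.suc _ } _ = vert P (suc zero) , arc P zero , arc-in P zero , step P zero

  strong⇒out-arc : Strong T → ∀ {x y} → x ≢ y → ∃[ q ] ∃[ e ] (Arc T e × Precedes x q e)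
  strong⇒out-arc strong x≢y with strong _ _ x≢y
  ... | P , refl , refl = first-step P x≢y

  c12Edge-to-one-of : 3 ≤ k → k < n → ∀ {c q y₁ y₂ e} → Arc T e → Precedes c q e →
    y₁ ≢ y₂ → c ≢ y₁ → c ≢ y₂ → q ≢ y₁ → q ≢ y₂ → C12Edge T c y₁ ⊎ C12Edge T c y₂
  c12Edge-to-one-of 3≤k k<n {c} {q} {y₁} {y₂} {e} E c→q y₁≢y₂ c≢y₁ c≢y₂ q≢y₁ q≢y₂
    with arc-containing T 3≤k k<n (lookup-injective₃ q≢y₁ q≢y₂ y₁≢y₂) (∉-∷ c≢q (∉-∷ c≢y₁ (∉-∷ c≢y₂ λ ())))
       | arc-containing T 3≤k k<n (lookup-injective₃ c≢y₁ c≢y₂ y₁≢y₂) (∉-∷ (≢-sym c≢q) (∉-∷ q≢y₁ (∉-∷ q≢y₂ λ ())))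
    where c≢q = arc-precedes⇒≢ E c→q
  ... | g , G , ⊆g , c∉g | h , H , ⊆h , q∉h =
    [ through y₂∈g c≢y₁ c≢y₂ q≢y₁ q≢y₂ , swap ∘ through y₁∈g c≢y₂ c≢y₁ q≢y₂ q≢y₁ ]′
      (precedes-total (⊆h (there (here refl))) (⊆h (there (there (here refl)))) y₁≢y₂)
    where
    y₁∈g = ⊆g (there (here refl))
    y₂∈g = ⊆g (there (there (here refl)))
    e≢g : e ≢ g
    e≢g e≡g = c∉g (subst (c ∈_) e≡g (precedes⇒∈ˡ c→q))
    e≢h : e ≢ h
    e≢h e≡h = q∉h (subst (q ∈_) e≡h (precedes⇒∈ʳ c→q))
    g≢h : g ≢ h
    g≢h g≡h = q∉h (subst (q ∈_) g≡h (⊆g (here refl)))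
    through : ∀ {u v} → v ∈ g → c ≢ u → c ≢ v → q ≢ u → q ≢ v →
      Precedes u v h → C12Edge T c u ⊎ C12Edge T c v
    through v∈g c≢u c≢v q≢u q≢v u→v with precedes-total (⊆g (here refl)) v∈g q≢v
    ... | inj₁ q→v = inj₁ (c12Edge₂₁ E G H e≢g e≢h g≢h c→q q→v u→v c≢u c≢v q≢u)
    ... | inj₂ v→q = inj₂ (c12Edge₁₁ E G e≢g c→q v→q c≢v)

corollary3p4 : (n k : ℕ) → 3 ≤ k → k < n → (T : Hypertournament n k) → Strong T →
    ¬ ContainsK13 (ComplEdge (C12Edge T))
corollary3p4 n k 3≤k k<n T strong
  (c , a , b , d , a≢b , a≢d , b≢d , (c≢a , ¬ca) , (c≢b , ¬cb) , (c≢d , ¬cd))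
  with strong⇒out-arc T strong c≢a
... | q , e , E , c→q with q ≟ a | q ≟ b
... | yes refl | _ = [ ¬cb , ¬cd ]′ (c12Edge-to-one-of T 3≤k k<n E c→q b≢d c≢b c≢d a≢b a≢d)
... | no q≢a | yes refl = [ ¬ca , ¬cd ]′ (c12Edge-to-one-of T 3≤k k<n E c→q a≢d c≢a c≢d (≢-sym a≢b) b≢d)
... | no q≢a | no q≢b = [ ¬ca , ¬cb ]′ (c12Edge-to-one-of T 3≤k k<n E c→q a≢b c≢a c≢b q≢a q≢b)
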